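{- Let ${\mathcal X}$ be a $k$-uniform family of subsets of a finite set $E$. Suppose that $E$ can be constructed by a weakly ${\mathcal X}$-saturated sequence from some $X_0\in{\mathcal X}$. Then the rank $k-1$ uniform matroid ${\mathcal U}_{k-1}(E)$ is the unique maximal ${\mathcal X}$-matroid on $E$ (in the weak order) and its rank function is ${\rm val}_{\mathcal X}$.
   Context: A family is $k$-uniform if every member has size $k$. A proper ${\mathcal X}$-sequence is a sequence $(X_1,\dots,X_m)$ of sets in ${\mathcal X}$ with $X_i\not\subseteq\bigcup_{j<i}X_j$ for $i\ge2$; for $F\subseteq E$, ${\rm val}(F,{\mathcal S})=|F\cup\bigcup_i X_i|-m$ and ${\rm val}_{\mathcal X}(F)=\min\{{\rm val}(F,{\mathcal S})\}$ over all proper ${\mathcal X}$-sequences ${\mathcal S}$. For $F_0\subseteq E$, a weakly ${\mathcal X}$-saturated sequence from $F_0$ is a proper ${\mathcal X}$-sequence $(X_1,\dots,X_m)$ with $|X_i\setminus(F_0\cup\bigcup_{j<i}X_j)|=1$ for all $i$; $F$ is constructed by it if $F=F_0\cup\bigcup_i X_i$. An ${\mathcal X}$-matroid on $E$ is a matroid on $E$ in which every set of ${\mathcal X}$ is a circuit. Weak order: ${\mathcal M}_1\preceq{\mathcal M}_2$ if every independent set of ${\mathcal M}_1$ is independent in ${\mathcal M}_2$. -}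

module Defs where

open import Data.Nat using (ℕ; zero; suc; _≤_; _<_)
open import Data.Integer as ℤ using (ℤ; +_; _-_)
open import Data.Fin using (Fin)
open import Data.Fin.Subset using (Subset; _∈_; _∉_; _⊆_; _⊈_; _⊂_; _∪_; _─_; ⋃; ⁅_⁆; ∣_∣; ⊥; ⊤)
open import Data.List using (List; []; _∷_; length)
open import Data.List.Relation.Unary.All using (All)
open import Data.Product using (Σ; _×_; ∃; _,_)
open import Data.Unit using () renaming (⊤ to Unit)
open import Relation.Nullary using (¬_)
open import Relation.Binary.PropositionalEquality using (_≡_)
open import Function.Bundles using (_⇔_)

Family : ℕ → Set₁
Family n = Subset n → Set

Uniform : ∀ {n} → ℕ → Family n → Set
Uniform k 𝒳 = ∀ X → 𝒳 X → ∣ X ∣ ≡ k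

-- Proper 𝒳-sequences: X_i ⊈ X_1 ∪ … ∪ X_{i-1} for i ≥ 2.

ProperFrom : ∀ {n} → Subset n → List (Subset n) → Set
ProperFrom U []       = Unit
ProperFrom U (X ∷ Xs) = (X ⊈ U) × ProperFrom (U ∪ X) Xs

Proper : ∀ {n} → Family n → List (Subset n) → Set
Proper 𝒳 []       = Unit
Proper 𝒳 (X ∷ Xs) = All 𝒳 (X ∷ Xs) × ProperFrom X Xs

val : ∀ {n} → Subset n → List (Subset n) → ℤ
val F S = + ∣ F ∪ ⋃ S ∣ - + length S

IsValX : ∀ {n} → Family n → Subset n → ℤ → Set
IsValX 𝒳 F v =
  (∃ λ S → Proper 𝒳 S × val F S ≡ v) ×
  (∀ S → Proper 𝒳 S → v ℤ.≤ val F S)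

WSatFrom : ∀ {n} → Subset n → List (Subset n) → Set
WSatFrom U []       = Unit
WSatFrom U (X ∷ Xs) = (∣ X ─ U ∣ ≡ 1) × WSatFrom (U ∪ X) Xs

WeaklySaturated : ∀ {n} → Family n → Subset n → List (Subset n) → Set
WeaklySaturated 𝒳 F₀ S = Proper 𝒳 S × WSatFrom F₀ S

ConstructedBy : ∀ {n} → Subset n → List (Subset n) → Subset n → Set
ConstructedBy F₀ S F = F ≡ F₀ ∪ ⋃ S

Indep : ℕ → Set₁
Indep n = Subset n → Set

record IsMatroid {n} (I : Indep n) : Set where
  field
    empty-indep : I ⊥
    down-closed : ∀ {A B} → A ⊆ B → I B → I A
    augment     : ∀ {A B} → I A → I B → ∣ A ∣ < ∣ B ∣ →
                  ∃ λ x → x ∈ B × x ∉ A × I (⁅ x ⁆ ∪ A)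

IsCircuit : ∀ {n} → Indep n → Subset n → Set
IsCircuit I C = ¬ I C × (∀ D → D ⊂ C → I D)

IsXMatroid : ∀ {n} → Family n → Indep n → Set
IsXMatroid 𝒳 I = IsMatroid I × (∀ X → 𝒳 X → IsCircuit I X)

_⪯_ : ∀ {n} → Indep n → Indep n → Set
M₁ ⪯ M₂ = ∀ A → M₁ A → M₂ A

_≋_ : ∀ {n} → Indep n → Indep n → Set
M₁ ≋ M₂ = ∀ A → M₁ A ⇔ M₂ A

IsMaximalXMatroid : ∀ {n} → Family n → Indep n → Set₁
IsMaximalXMatroid 𝒳 M =
  IsXMatroid 𝒳 M × (∀ M' → IsXMatroid 𝒳 M' → M ⪯ M' → M' ⪯ M)

𝒰 : ∀ {n} → ℕ → Indep n
𝒰 r A = ∣ A ∣ ≤ r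

IsRank : ∀ {n} → Indep n → Subset n → ℕ → Set
IsRank M F r =
  (∃ λ A → A ⊆ F × M A × ∣ A ∣ ≡ r) ×
  (∀ A → A ⊆ F → M A → ∣ A ∣ ≤ r)

-- In an 𝒳-matroid, a circuit X of size k + 1 has rank k, and adding to a set U
-- of rank at most k such a circuit X with a single element e outside U keeps
-- the rank at most k: an independent set of size k + 1 in U ∪ X would augment
-- the independent set X - e by some x, and either x = e, so that (X - e) + x
-- contains the dependent X, or x ∈ U, giving an independent subset of U of size
-- k + 1. Along the weakly saturated sequence E itself gets rank at most k, so
-- every 𝒳-matroid lies below the 𝒳-matroid 𝒰_k(E). A proper sequence of m ≥ 1
-- members of 𝒳 covers at least k + m elements, so val(F, S) ≥ min(|F|, k); the
-- empty sequence attains |F|, and the saturated sequence X₀, X₁, …, whose m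
-- members cover all k + m elements of E, attains k.
module Submission where

open import Defs
open import Data.Nat using (ℕ; zero; suc; _+_; _∸_; _⊓_; _≤_; _<_; z≤n; s≤s; s≤s⁻¹; _≤?_)
open import Data.Nat.Properties
  using ( ≤-reflexive; ≤-trans; ≤-total; ≤-<-trans; ≰⇒>; <⇒≢; <⇒≱; 1+n≰n; suc-injective
        ; +-suc; +-assoc; +-identityʳ; +-monoˡ-≤; m≤n+m; m<m+n; m+n∸n≡m; m+n≤o⇒m≤o∸n
        ; m⊓n≤m; m⊓n≤n; ⊓-glb; m≤n⇒m⊓n≡m; m≥n⇒m⊓n≡n; module ≤-Reasoning )
open import Data.Integer as ℤ using (+_; _⊖_)
open import Data.Integer.Properties as ℤ using (m-n≡m⊖n; ⊖-≥)
open import Data.Fin using (_≟_) renaming (zero to fzero; suc to fsuc)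
open import Data.Fin.Subset
  using (Subset; Nonempty; _∈_; _∉_; _⊆_; _⊈_; _∪_; _─_; _-_; ⋃; ⁅_⁆; ∣_∣; ⊥; ⊤)
open import Data.Fin.Subset.Properties
open import Data.Bool using (true; false)
open import Data.Vec using ([]; _∷_; here; there)
open import Data.List using ([]; _∷_; length)
open import Data.List.Relation.Unary.All using (All; []; _∷_)
open import Data.Product using (_×_; ∃; _,_; map; map₁)
open import Data.Sum using (_⊎_; inj₁; inj₂)
open import Data.Unit using (tt)
open import Relation.Nullary using (¬_; yes; no; contradiction)
open import Relation.Binary.PropositionalEquality
  using (_≡_; refl; sym; trans; cong; subst; module ≡-Reasoning)
open import Function using (_∘_)
open import Function.Bundles using (mk⇔)

private
  variable
    n k : ℕ

module _ {p : Subset n} where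

  Nonempty⇒0<∣p∣ : Nonempty p → 0 < ∣ p ∣
  Nonempty⇒0<∣p∣ (_ , x∈p) = ≤-<-trans z≤n (x∈p⇒∣p-x∣<∣p∣ x∈p)

  ∣p∣≡0⇒p≡⊥ : ∣ p ∣ ≡ 0 → p ≡ ⊥
  ∣p∣≡0⇒p≡⊥ ∣p∣≡0 = Empty-unique (λ ne → <⇒≢ (Nonempty⇒0<∣p∣ ne) (sym ∣p∣≡0))

  0<∣p∣⇒Nonempty : 0 < ∣ p ∣ → Nonempty p
  0<∣p∣⇒Nonempty 0<∣p∣ with nonempty? p
  ... | yes ne   = ne
  ... | no empty =
    contradiction (sym (trans (cong ∣_∣ (Empty-unique empty)) (∣⊥∣≡0 n))) (<⇒≢ 0<∣p∣)

∣p∣≡1⇒p≡⁅x⁆ : (p : Subset n) → ∣ p ∣ ≡ 1 → ∃ λ x → p ≡ ⁅ x ⁆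
∣p∣≡1⇒p≡⁅x⁆ (true  ∷ p) ∣p∣≡1 = fzero , cong (true ∷_) (∣p∣≡0⇒p≡⊥ (suc-injective ∣p∣≡1))
∣p∣≡1⇒p≡⁅x⁆ (false ∷ p) ∣p∣≡1 = map fsuc (cong (false ∷_)) (∣p∣≡1⇒p≡⁅x⁆ p ∣p∣≡1)

x∈p─q⇒x∉q : ∀ (p q : Subset n) {x} → x ∈ p ─ q → x ∉ q
x∈p─q⇒x∉q (_ ∷ p) (true  ∷ q) () here
x∈p─q⇒x∉q (_ ∷ p) (_     ∷ q) (there x∈p─q) (there x∈q) = x∈p─q⇒x∉q p q x∈p─q x∈q

x∉p⇒∣⁅x⁆∪p∣≡1+∣p∣ : ∀ {x} (p : Subset n) → x ∉ p → ∣ ⁅ x ⁆ ∪ p ∣ ≡ suc ∣ p ∣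
x∉p⇒∣⁅x⁆∪p∣≡1+∣p∣ {x = fzero}  (true  ∷ p) x∉p = contradiction here x∉p
x∉p⇒∣⁅x⁆∪p∣≡1+∣p∣ {x = fzero}  (false ∷ p) _   = cong (suc ∘ ∣_∣) (∪-identityˡ p)
x∉p⇒∣⁅x⁆∪p∣≡1+∣p∣ {x = fsuc x} (true  ∷ p) x∉p = cong suc (x∉p⇒∣⁅x⁆∪p∣≡1+∣p∣ p (x∉p ∘ there))
x∉p⇒∣⁅x⁆∪p∣≡1+∣p∣ {x = fsuc x} (false ∷ p) x∉p = x∉p⇒∣⁅x⁆∪p∣≡1+∣p∣ p (x∉p ∘ there)

x∈p⇒∣p∣≡1+∣p-x∣ : ∀ {p : Subset n} {x} → x ∈ p → ∣ p ∣ ≡ suc ∣ p - x ∣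
x∈p⇒∣p∣≡1+∣p-x∣ {p = true  ∷ p} here         = cong (suc ∘ ∣_∣) (sym (p─⊥≡p p))
x∈p⇒∣p∣≡1+∣p-x∣ {p = true  ∷ p} (there x∈p) = cong suc (x∈p⇒∣p∣≡1+∣p-x∣ x∈p)
x∈p⇒∣p∣≡1+∣p-x∣ {p = false ∷ p} (there x∈p) = x∈p⇒∣p∣≡1+∣p-x∣ x∈p

∣p∣≡1+m⇒∣p-x∣≡m : ∀ {p : Subset n} {x m} → x ∈ p → ∣ p ∣ ≡ suc m → ∣ p - x ∣ ≡ m
∣p∣≡1+m⇒∣p-x∣≡m x∈p ∣p∣≡1+m = suc-injective (trans (sym (x∈p⇒∣p∣≡1+∣p-x∣ x∈p)) ∣p∣≡1+m)

∣p∪q∣≡∣p∣+∣q─p∣ : (p q : Subset n) → ∣ p ∪ q ∣ ≡ ∣ p ∣ + ∣ q ─ p ∣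
∣p∪q∣≡∣p∣+∣q─p∣ []          []          = refl
∣p∪q∣≡∣p∣+∣q─p∣ (true  ∷ p) (_     ∷ q) = cong suc (∣p∪q∣≡∣p∣+∣q─p∣ p q)
∣p∪q∣≡∣p∣+∣q─p∣ (false ∷ p) (true  ∷ q) =
  trans (cong suc (∣p∪q∣≡∣p∣+∣q─p∣ p q)) (sym (+-suc ∣ p ∣ ∣ q ─ p ∣))
∣p∪q∣≡∣p∣+∣q─p∣ (false ∷ p) (false ∷ q) = ∣p∪q∣≡∣p∣+∣q─p∣ p q

p─q≡⊥⇒p⊆q : {p q : Subset n} → p ─ q ≡ ⊥ → p ⊆ q
p─q≡⊥⇒p⊆q {q = q} p─q≡⊥ {x} x∈p with x ∈? q
... | yes x∈q = x∈q
... | no  x∉q = contradiction (subst (x ∈_) p─q≡⊥ (x∈p∧x∉q⇒x∈p─q x∈p x∉q)) ∉⊥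

p⊈q⇒Nonempty[p─q] : {p q : Subset n} → p ⊈ q → Nonempty (p ─ q)
p⊈q⇒Nonempty[p─q] {p = p} {q} p⊈q with nonempty? (p ─ q)
... | yes ne   = ne
... | no empty = contradiction (λ {x} → p─q≡⊥⇒p⊆q (Empty-unique empty) {x}) p⊈q

p⊆⁅x⁆∪p-x : ∀ (p : Subset n) x → p ⊆ ⁅ x ⁆ ∪ (p - x)
p⊆⁅x⁆∪p-x p x {y} y∈p with y ≟ x
... | yes refl = x∈p∪q⁺ (inj₁ (x∈⁅x⁆ x))
... | no  y≢x  = x∈p∪q⁺ (inj₂ (x∈p∧x≢y⇒x∈p-y y∈p y≢x))

x∈q∧p⊆q⇒⁅x⁆∪p⊆q : ∀ {p q : Subset n} {x} → x ∈ q → p ⊆ q → ⁅ x ⁆ ∪ p ⊆ q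
x∈q∧p⊆q⇒⁅x⁆∪p⊆q {p = p} {x = x} x∈q p⊆q y∈⁅x⁆∪p with x∈p∪q⁻ ⁅ x ⁆ p y∈⁅x⁆∪p
... | inj₁ y∈⁅x⁆ = subst (_∈ _) (sym (x∈⁅y⁆⇒x≡y x y∈⁅x⁆)) x∈q
... | inj₂ y∈p   = p⊆q y∈p

∣p─q∣≡1⇒∃[x]p-x⊆q : (p q : Subset n) → ∣ p ─ q ∣ ≡ 1 → ∃ λ x → x ∈ p × x ∉ q × p - x ⊆ q
∣p─q∣≡1⇒∃[x]p-x⊆q p q ∣p─q∣≡1 with ∣p∣≡1⇒p≡⁅x⁆ (p ─ q) ∣p─q∣≡1
... | x , p─q≡⁅x⁆ = x , p─q⊆p p q x∈p─q , x∈p─q⇒x∉q p q x∈p─q , p-x⊆q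
  where
  x∈p─q : x ∈ p ─ q
  x∈p─q = subst (x ∈_) (sym p─q≡⁅x⁆) (x∈⁅x⁆ x)
  p-x⊆q : p - x ⊆ q
  p-x⊆q {y} y∈p-x with y ∈? q
  ... | yes y∈q = y∈q
  ... | no  y∉q = contradiction (subst (y ∈_) p─q≡⁅x⁆ (x∈p∧x∉q⇒x∈p─q (p─q⊆p p ⁅ x ⁆ y∈p-x) y∉q))
                                 (x∈p─q⇒x∉q p ⁅ x ⁆ y∈p-x)

∃⊆∧∣∣≡ : ∀ m (p : Subset n) → m ≤ ∣ p ∣ → ∃ λ q → q ⊆ p × ∣ q ∣ ≡ m
∃⊆∧∣∣≡ {n} zero    p           _           = ⊥ , ⊥⊆ , ∣⊥∣≡0 n
∃⊆∧∣∣≡     (suc m) (true  ∷ p) (s≤s m≤∣p∣) =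
  map (true ∷_) (map s⊆s (cong suc)) (∃⊆∧∣∣≡ m p m≤∣p∣)
∃⊆∧∣∣≡     (suc m) (false ∷ p) 1+m≤∣p∣     =
  map (false ∷_) (map₁ out⊆) (∃⊆∧∣∣≡ (suc m) p 1+m≤∣p∣)

RankAtMost : Indep n → ℕ → Subset n → Set
RankAtMost M r U = ∀ A → A ⊆ U → M A → ∣ A ∣ ≤ r

rankAtMost-⊆ : ∀ {M : Indep n} {r U V} → V ⊆ U → RankAtMost M r U → RankAtMost M r V
rankAtMost-⊆ V⊆U rank≤r A A⊆V = rank≤r A (V⊆U ∘ A⊆V)

rankAtMost-∣∣ : ∀ {M : Indep n} U → RankAtMost M ∣ U ∣ U
rankAtMost-∣∣ U A A⊆U _ = p⊆q⇒∣p∣≤∣q∣ A⊆U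

module _ {M : Indep n} (isMatroid : IsMatroid M) where
  open IsMatroid isMatroid

  rankAtMost-∪-circuit : ∀ {C U e} → IsCircuit M C → ∣ C ∣ ≡ suc k → e ∈ C → C - e ⊆ U →
                         RankAtMost M k U → RankAtMost M k (U ∪ C)
  rankAtMost-∪-circuit {k} {C} {U} {e} (C-dependent , C-minimal) ∣C∣≡1+k e∈C C-e⊆U rank≤k
                       A A⊆U∪C A-indep with ∣ A ∣ ≤? k
  ... | yes ∣A∣≤k = ∣A∣≤k
  ... | no  ∣A∣≰k = contradiction (augment B-indep A-indep ∣B∣<∣A∣) no-augmentation
    where
    B = C - e
    ∣B∣≡k : ∣ B ∣ ≡ k
    ∣B∣≡k = ∣p∣≡1+m⇒∣p-x∣≡m e∈C ∣C∣≡1+k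
    ∣B∣<∣A∣ : ∣ B ∣ < ∣ A ∣
    ∣B∣<∣A∣ = subst (_< ∣ A ∣) (sym ∣B∣≡k) (≰⇒> ∣A∣≰k)
    B-indep : M B
    B-indep = C-minimal B (x∈p⇒p-x⊂p e∈C)
    no-augmentation : ¬ (∃ λ x → x ∈ A × x ∉ B × M (⁅ x ⁆ ∪ B))
    no-augmentation (x , x∈A , x∉B , B+x-indep) with x∈p∪q⁻ U C (A⊆U∪C x∈A)
    ... | inj₁ x∈U =
      1+n≰n (subst (_≤ k) ∣B+x∣≡1+k (rank≤k _ (x∈q∧p⊆q⇒⁅x⁆∪p⊆q x∈U C-e⊆U) B+x-indep))
      where
      ∣B+x∣≡1+k : ∣ ⁅ x ⁆ ∪ B ∣ ≡ suc k
      ∣B+x∣≡1+k = trans (x∉p⇒∣⁅x⁆∪p∣≡1+∣p∣ B x∉B) (cong suc ∣B∣≡k)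
    ... | inj₂ x∈C with x ≟ e
    ...   | yes refl = C-dependent (down-closed (p⊆⁅x⁆∪p-x C x) B+x-indep)
    ...   | no  x≢e  = x∉B (x∈p∧x≢y⇒x∈p-y x∈C x≢e)

  rankAtMost-circuit : ∀ {C} → IsCircuit M C → ∣ C ∣ ≡ suc k → RankAtMost M k C
  rankAtMost-circuit {k} {C} C-circuit ∣C∣≡1+k
    with 0<∣p∣⇒Nonempty (subst (0 <_) (sym ∣C∣≡1+k) (s≤s z≤n))
  ... | e , e∈C = rankAtMost-⊆ (q⊆p∪q (C - e) C)
                    (rankAtMost-∪-circuit C-circuit ∣C∣≡1+k e∈C ⊆-refl rank[C-e]≤k)
    where
    rank[C-e]≤k : RankAtMost M k (C - e)
    rank[C-e]≤k = subst (λ r → RankAtMost M r (C - e))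
                    (∣p∣≡1+m⇒∣p-x∣≡m e∈C ∣C∣≡1+k) (rankAtMost-∣∣ (C - e))

𝒰-isMatroid : IsMatroid {n} (𝒰 k)
𝒰-isMatroid {n} {k} = record
  { empty-indep = subst (_≤ k) (sym (∣⊥∣≡0 n)) z≤n
  ; down-closed = λ B⊆A ∣A∣≤k → ≤-trans (p⊆q⇒∣p∣≤∣q∣ B⊆A) ∣A∣≤k
  ; augment     = augment
  }
  where
  augment : ∀ {A B} → 𝒰 k A → 𝒰 k B → ∣ A ∣ < ∣ B ∣ → ∃ λ x → x ∈ B × x ∉ A × 𝒰 k (⁅ x ⁆ ∪ A)
  augment {A} {B} _ ∣B∣≤k ∣A∣<∣B∣
    with p⊈q⇒Nonempty[p─q] (λ B⊆A → <⇒≱ ∣A∣<∣B∣ (p⊆q⇒∣p∣≤∣q∣ B⊆A))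
  ... | x , x∈B─A = x , p─q⊆p B A x∈B─A , x∉A ,
                    subst (_≤ k) (sym (x∉p⇒∣⁅x⁆∪p∣≡1+∣p∣ A x∉A)) (≤-trans ∣A∣<∣B∣ ∣B∣≤k)
    where
    x∉A = x∈p─q⇒x∉q B A x∈B─A

𝒰-isXMatroid : ∀ {𝒳 : Family n} → Uniform (suc k) 𝒳 → IsXMatroid 𝒳 (𝒰 k)
𝒰-isXMatroid uniform = 𝒰-isMatroid , λ X X∈𝒳 →
  (λ ∣X∣≤k → 1+n≰n (subst (_≤ _) (uniform X X∈𝒳) ∣X∣≤k)) ,
  (λ D D⊂X → s≤s⁻¹ (subst (∣ D ∣ <_) (uniform X X∈𝒳) (p⊂q⇒∣p∣<∣q∣ D⊂X)))

𝒰-rank : ∀ (F : Subset n) → IsRank (𝒰 k) F (∣ F ∣ ⊓ k)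
𝒰-rank {k = k} F with ∃⊆∧∣∣≡ (∣ F ∣ ⊓ k) F (m⊓n≤m ∣ F ∣ k)
... | A , A⊆F , ∣A∣≡r =
  (A , A⊆F , subst (_≤ k) (sym ∣A∣≡r) (m⊓n≤n ∣ F ∣ k) , ∣A∣≡r) ,
  λ B B⊆F ∣B∣≤k → ⊓-glb (p⊆q⇒∣p∣≤∣q∣ B⊆F) ∣B∣≤k

∣∪⋃∣-wsat : ∀ S (U : Subset n) → WSatFrom U S → ∣ U ∪ ⋃ S ∣ ≡ ∣ U ∣ + length S
∣∪⋃∣-wsat []      U _                 = trans (cong ∣_∣ (∪-identityʳ U)) (sym (+-identityʳ ∣ U ∣))
∣∪⋃∣-wsat (X ∷ S) U (∣X─U∣≡1 , sat) = begin
  ∣ U ∪ (X ∪ ⋃ S) ∣                ≡⟨ cong ∣_∣ (∪-assoc U X (⋃ S)) ⟨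
  ∣ (U ∪ X) ∪ ⋃ S ∣                ≡⟨ ∣∪⋃∣-wsat S (U ∪ X) sat ⟩
  (∣ U ∪ X ∣ + length S)           ≡⟨ cong (_+ length S) (∣p∪q∣≡∣p∣+∣q─p∣ U X) ⟩
  (∣ U ∣ + ∣ X ─ U ∣ + length S)   ≡⟨ cong (λ m → ∣ U ∣ + m + length S) ∣X─U∣≡1 ⟩
  (∣ U ∣ + 1 + length S)           ≡⟨ +-assoc ∣ U ∣ 1 (length S) ⟩
  (∣ U ∣ + suc (length S))         ∎
  where open ≡-Reasoning

∣∪⋃∣-proper : ∀ S (U : Subset n) → ProperFrom U S → ∣ U ∣ + length S ≤ ∣ U ∪ ⋃ S ∣
∣∪⋃∣-proper []      U _              = ≤-reflexive (sym (∣∪⋃∣-wsat [] U tt))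
∣∪⋃∣-proper (X ∷ S) U (X⊈U , proper) = begin
  (∣ U ∣ + suc (length S))    ≡⟨ +-suc ∣ U ∣ (length S) ⟩
  (suc ∣ U ∣ + length S)      ≤⟨ +-monoˡ-≤ (length S) 1+∣U∣≤∣U∪X∣ ⟩
  (∣ U ∪ X ∣ + length S)      ≤⟨ ∣∪⋃∣-proper S (U ∪ X) proper ⟩
  ∣ (U ∪ X) ∪ ⋃ S ∣           ≡⟨ cong ∣_∣ (∪-assoc U X (⋃ S)) ⟩
  ∣ U ∪ (X ∪ ⋃ S) ∣           ∎
  where
  open ≤-Reasoning
  1+∣U∣≤∣U∪X∣ : suc ∣ U ∣ ≤ ∣ U ∪ X ∣
  1+∣U∣≤∣U∪X∣ = subst (∣ U ∣ <_) (sym (∣p∪q∣≡∣p∣+∣q─p∣ U X))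
                  (m<m+n ∣ U ∣ (Nonempty⇒0<∣p∣ (p⊈q⇒Nonempty[p─q] X⊈U)))

wsat⇒proper : ∀ S (U : Subset n) → WSatFrom U S → ProperFrom U S
wsat⇒proper []      U _                 = tt
wsat⇒proper (X ∷ S) U (∣X─U∣≡1 , sat) with ∣p─q∣≡1⇒∃[x]p-x⊆q X U ∣X─U∣≡1
... | _ , x∈X , x∉U , _ = (λ X⊆U → x∉U (X⊆U x∈X)) , wsat⇒proper S (U ∪ X) sat

val≡ : ∀ r (F : Subset n) S → ∣ F ∪ ⋃ S ∣ ≡ r + length S → val F S ≡ + r
val≡ r F S ∣F∪⋃S∣≡r+ℓ = begin
  + ∣ F ∪ ⋃ S ∣ ℤ.- + length S  ≡⟨ m-n≡m⊖n ∣ F ∪ ⋃ S ∣ (length S) ⟩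
  ∣ F ∪ ⋃ S ∣ ⊖ length S        ≡⟨ cong (_⊖ length S) ∣F∪⋃S∣≡r+ℓ ⟩
  (r + length S) ⊖ length S     ≡⟨ ⊖-≥ (m≤n+m (length S) r) ⟩
  + (r + length S ∸ length S)   ≡⟨ cong +_ (m+n∸n≡m r (length S)) ⟩
  + r                           ∎
  where open ≡-Reasoning

≤val : ∀ r (F : Subset n) S → r + length S ≤ ∣ F ∪ ⋃ S ∣ → + r ℤ.≤ val F S
≤val r F S r+ℓ≤∣F∪⋃S∣ = begin
  + r                            ≤⟨ ℤ.+≤+ (m+n≤o⇒m≤o∸n r r+ℓ≤∣F∪⋃S∣) ⟩
  + (∣ F ∪ ⋃ S ∣ ∸ length S)     ≡⟨ ⊖-≥ (≤-trans (m≤n+m (length S) r) r+ℓ≤∣F∪⋃S∣) ⟨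
  ∣ F ∪ ⋃ S ∣ ⊖ length S         ≡⟨ m-n≡m⊖n ∣ F ∪ ⋃ S ∣ (length S) ⟨
  val F S                        ∎
  where open ℤ.≤-Reasoning

proper⇒All : ∀ {𝒳 : Family n} S → Proper 𝒳 S → All 𝒳 S
proper⇒All []      _             = []
proper⇒All (_ ∷ _) (S∈𝒳 , _) = S∈𝒳

module _ {𝒳 : Family n} (uniform : Uniform (suc k) 𝒳) where

  rankAtMost-wsat : ∀ {M} → IsXMatroid 𝒳 M → ∀ S U → All 𝒳 S → WSatFrom U S →
                    RankAtMost M k U → RankAtMost M k (U ∪ ⋃ S)
  rankAtMost-wsat _ [] U _ _ rank≤k = rankAtMost-⊆ (⊆-reflexive (∪-identityʳ U)) rank≤k
  rankAtMost-wsat M-𝒳@(isMatroid , circuit) (X ∷ S) U (X∈𝒳 ∷ S∈𝒳) (∣X─U∣≡1 , sat) rank≤k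
    with ∣p─q∣≡1⇒∃[x]p-x⊆q X U ∣X─U∣≡1
  ... | e , e∈X , _ , X-e⊆U =
    rankAtMost-⊆ (⊆-reflexive (sym (∪-assoc U X (⋃ S))))
      (rankAtMost-wsat M-𝒳 S (U ∪ X) S∈𝒳 sat
        (rankAtMost-∪-circuit isMatroid (circuit X X∈𝒳) (uniform X X∈𝒳) e∈X X-e⊆U rank≤k))

  saturated⇒⪯𝒰 : ∀ {M X₀ S} → IsXMatroid 𝒳 M → 𝒳 X₀ → WeaklySaturated 𝒳 X₀ S →
                  ConstructedBy X₀ S ⊤ → M ⪯ 𝒰 k
  saturated⇒⪯𝒰 {X₀ = X₀} {S} M-𝒳@(isMatroid , circuit) X₀∈𝒳 (S-proper , S-sat) E≡X₀∪⋃S A A-indep =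
    subst (RankAtMost _ k) (sym E≡X₀∪⋃S)
      (rankAtMost-wsat M-𝒳 S X₀ (proper⇒All S S-proper) S-sat
        (rankAtMost-circuit isMatroid (circuit X₀ X₀∈𝒳) (uniform X₀ X₀∈𝒳)))
      A ⊆⊤ A-indep

  val-lowerBound : ∀ (F : Subset n) S → Proper 𝒳 S → + (∣ F ∣ ⊓ k) ℤ.≤ val F S
  val-lowerBound F []      _ = ≤val (∣ F ∣ ⊓ k) F [] (begin
    (∣ F ∣ ⊓ k + 0)  ≡⟨ +-identityʳ (∣ F ∣ ⊓ k) ⟩
    ∣ F ∣ ⊓ k        ≤⟨ m⊓n≤m ∣ F ∣ k ⟩
    ∣ F ∣            ≡⟨ cong ∣_∣ (∪-identityʳ F) ⟨
    ∣ F ∪ ⊥ ∣        ∎)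
    where open ≤-Reasoning
  val-lowerBound F (X ∷ S) (X∈𝒳 ∷ _ , proper) = ≤val (∣ F ∣ ⊓ k) F (X ∷ S) (begin
    (∣ F ∣ ⊓ k + suc (length S))  ≤⟨ +-monoˡ-≤ (suc (length S)) (m⊓n≤n ∣ F ∣ k) ⟩
    (k + suc (length S))          ≡⟨ +-suc k (length S) ⟩
    (suc k + length S)            ≡⟨ cong (_+ length S) (uniform X X∈𝒳) ⟨
    (∣ X ∣ + length S)            ≤⟨ ∣∪⋃∣-proper S X proper ⟩
    ∣ X ∪ ⋃ S ∣                   ≤⟨ ∣q∣≤∣p∪q∣ F (X ∪ ⋃ S) ⟩
    ∣ F ∪ (X ∪ ⋃ S) ∣             ∎)
    where open ≤-Reasoning

  val-saturated : ∀ {X₀ S} (F : Subset n) → 𝒳 X₀ → WSatFrom X₀ S → ConstructedBy X₀ S ⊤ →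
                  val F (X₀ ∷ S) ≡ + k
  val-saturated {X₀} {S} F X₀∈𝒳 sat E≡X₀∪⋃S = val≡ k F (X₀ ∷ S) (begin
    ∣ F ∪ (X₀ ∪ ⋃ S) ∣      ≡⟨ cong (∣_∣ ∘ (F ∪_)) E≡X₀∪⋃S ⟨
    ∣ F ∪ ⊤ ∣               ≡⟨ cong ∣_∣ (trans (∪-zeroʳ F) E≡X₀∪⋃S) ⟩
    ∣ X₀ ∪ ⋃ S ∣            ≡⟨ ∣∪⋃∣-wsat S X₀ sat ⟩
    (∣ X₀ ∣ + length S)     ≡⟨ cong (_+ length S) (uniform X₀ X₀∈𝒳) ⟩
    (suc k + length S)      ≡⟨ +-suc k (length S) ⟨
    (k + suc (length S))    ∎)
    where open ≡-Reasoning

  isValX : ∀ {X₀ S} → 𝒳 X₀ → WeaklySaturated 𝒳 X₀ S → ConstructedBy X₀ S ⊤ →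
           ∀ F → IsValX 𝒳 F (+ (∣ F ∣ ⊓ k))
  isValX {X₀} {S} X₀∈𝒳 (S-proper , sat) E≡X₀∪⋃S F =
    attained (≤-total ∣ F ∣ k) , val-lowerBound F
    where
    attained : ∣ F ∣ ≤ k ⊎ k ≤ ∣ F ∣ → ∃ λ S′ → Proper 𝒳 S′ × val F S′ ≡ + (∣ F ∣ ⊓ k)
    attained (inj₁ ∣F∣≤k) = [] , tt ,
      val≡ (∣ F ∣ ⊓ k) F [] (trans (cong ∣_∣ (∪-identityʳ F))
        (trans (sym (m≤n⇒m⊓n≡m ∣F∣≤k)) (sym (+-identityʳ (∣ F ∣ ⊓ k)))))
    attained (inj₂ k≤∣F∣) = X₀ ∷ S , (X₀∈𝒳 ∷ proper⇒All S S-proper , wsat⇒proper S X₀ sat) ,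
      trans (val-saturated F X₀∈𝒳 sat E≡X₀∪⋃S) (cong +_ (sym (m≥n⇒m⊓n≡n k≤∣F∣)))

lemma3p1 : (n k : ℕ) (𝒳 : Family n) → Uniform (suc k) 𝒳 →
    (∃ λ X₀ → 𝒳 X₀ × (∃ λ S → WeaklySaturated 𝒳 X₀ S × ConstructedBy X₀ S ⊤)) →
    (IsXMatroid 𝒳 (𝒰 k) ×
     (∀ M → IsXMatroid 𝒳 M → M ⪯ 𝒰 k) ×
     (∀ M → IsMaximalXMatroid 𝒳 M → M ≋ 𝒰 k)) ×
    (∀ F → ∃ λ r → IsRank (𝒰 k) F r × IsValX 𝒳 F (+ r))
lemma3p1 n k 𝒳 uniform (X₀ , X₀∈𝒳 , S , sat , E≡X₀∪⋃S) =
  (𝒰-isXMatroid uniform , ⪯𝒰 , maximal⇒≋𝒰) ,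
  λ F → ∣ F ∣ ⊓ k , 𝒰-rank F , isValX uniform X₀∈𝒳 sat E≡X₀∪⋃S F
  where
  ⪯𝒰 : ∀ M → IsXMatroid 𝒳 M → M ⪯ 𝒰 k
  ⪯𝒰 M M-𝒳 = saturated⇒⪯𝒰 uniform M-𝒳 X₀∈𝒳 sat E≡X₀∪⋃S
  maximal⇒≋𝒰 : ∀ M → IsMaximalXMatroid 𝒳 M → M ≋ 𝒰 k
  maximal⇒≋𝒰 M (M-𝒳 , maximal) A =
    mk⇔ (⪯𝒰 M M-𝒳 A) (maximal (𝒰 k) (𝒰-isXMatroid uniform) (⪯𝒰 M M-𝒳) A)
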